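{- Let $p(x)=\sum_{i=0}^m d_ix^i$ be a skew-palindromic polynomial of degree $m=2m'+1$ over a field $F$ of characteristic zero, and let $d_{k,n}$ denote the entries of its binomial array $B(d_i)$. For $t\ge1$ let $D_t:=d_{m'+t,\,2t}$. Then for all $t\ge1$, $$D_t=\sum_{i=0}^{m'}d_i\,c_{m-2i}(t),$$ where for $j\ge0$, $c_{2j+1}(t)$ denotes the coefficient of $x^{j+t}$ in $(1+x)^{2t}(1-x^{2j+1})$ (explicitly, $c_1(t)=C_t=\frac{1}{t+1}\binom{2t}{t}$ and $c_{2j+1}(t)=\frac{2j+1}{t+j+1}\binom{2t}{t-j}$).
   Context: A polynomial of degree $m$ is skew-palindromic if $p(x)=-x^mp(1/x)$, i.e. $d_i=-d_{m-i}$. The binomial array $B(d_i)$ has entries $d_{k,n}$ equal to the coefficient of $x^k$ in $(1+x)^np(x)$. The entries $d_{m'+t,2t-1}$ are zero, and $D_t$ is the near-zero sequence to their right; $c_{2j+1}(t)$ is the entry in row $j+t$, column $2t$ of the binomial array $B(1-x^{2j+1})$. -}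

module Defs where

open import Level using (Level; _⊔_)
open import Data.Nat using (ℕ; zero; suc; _∸_; _≡ᵇ_; _≤_)
open import Data.Nat.Combinatorics using (_C_)
open import Data.Bool using (if_then_else_)
open import Data.Product using (∃)
open import Relation.Nullary using (¬_)
open import Algebra.Bundles using (CommutativeRing)

module _ {c ℓ : Level} (R : CommutativeRing c ℓ) where
  open CommutativeRing R

  ⟦_⟧ : ℕ → Carrier
  ⟦ zero ⟧  = 0#
  ⟦ suc n ⟧ = 1# + ⟦ n ⟧

  Σ≤ : ℕ → (ℕ → Carrier) → Carrier
  Σ≤ zero    f = f 0
  Σ≤ (suc n) f = Σ≤ n f + f (suc n)

  record IsCharZeroField : Set (c ⊔ ℓ) where
    field
      nontrivial : ¬ (1# ≈ 0#)
      inverses   : ∀ x → ¬ (x ≈ 0#) → ∃ λ y → x * y ≈ 1#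
      charZero   : ∀ n → ¬ (⟦ suc n ⟧ ≈ 0#)

  -- A polynomial is a coefficient sequence q : ℕ → F (q i = coeff of x^i).
  -- p has degree m
  HasDegree : (ℕ → Carrier) → ℕ → Set ℓ
  HasDegree q m = ¬ (q m ≈ 0#) × (∀ i → m Data.Nat.< i → q i ≈ 0#)
    where open import Data.Product using (_×_)
          import Data.Nat

  SkewPalindromic : (ℕ → Carrier) → ℕ → Set ℓ
  SkewPalindromic q m = ∀ i → i ≤ m → q i ≈ - q (m ∸ i)

  -- binomial array B(q): entry (k , n) = coefficient of x^k in (1+x)^n q(x)
  --                    = Σ_{i=0}^{k} binom(n, k-i) q_i
  binArr : (ℕ → Carrier) → ℕ → ℕ → Carrier
  binArr q k n = Σ≤ k (λ i → ⟦ n C (k ∸ i) ⟧ * q i)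

  -- coefficients of 1 - x^{2j+1}
  oneMinusX^ : ℕ → ℕ → Carrier
  oneMinusX^ j zero    = 1#
  oneMinusX^ j (suc i) = if i ≡ᵇ (j Data.Nat.+ j) then - 1# else 0#
    where import Data.Nat

  c[2_+1] : ℕ → ℕ → Carrier
  c[2 j +1] t = binArr (oneMinusX^ j) (j Data.Nat.+ t) (t Data.Nat.+ t)
    where import Data.Nat

-- Pair the index i ≤ m′ of the sum D_t = Σ_i binom(2t, m′+t−i) d_i with its mirror m − i and use
-- d_{m−i} = − d_i: the pair contributes d_i (binom(2t, m′+t−i) − binom(2t, m′+t−(m−i))), and with
-- j = m′ − i this difference is binom(2t, j+t) − binom(2t, j+t−(2j+1)), i.e. the entry of
-- B(1 − x^{2j+1}) defining c_{2j+1}(t).  The argument works over any commutative ring, for every t,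
-- and with any column n in place of 2t.
module Submission where

open import Defs
open import Level using (Level)
open import Data.Nat using (ℕ; suc; _+_; _*_; _∸_; _≥_)
open import Algebra.Bundles using (CommutativeRing)

open import Data.Nat using (zero; _≤_; _<_; _≤′_; _≤?_; _≡ᵇ_; z≤n; s≤s)
open import Data.Nat.Base using (≤′-refl; ≤′-step)
import Data.Nat.Properties as ℕ
open import Data.Nat.Tactic.RingSolver using (solve-∀)
open import Data.Nat.Combinatorics using (_C_)
open import Data.Bool using (true; false)
open import Data.Product using (_,_)
open import Data.Empty using (⊥-elim)
open import Relation.Nullary using (yes; no)
open import Relation.Binary.PropositionalEquality as P using (_≡_; _≢_)

module _ {c ℓ : Level} (R : CommutativeRing c ℓ) where
  open CommutativeRing R renaming (_+_ to _⊕_; _*_ to _⊛_)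
  open import Relation.Binary.Reasoning.Setoid setoid
  open import Algebra.Properties.Ring ring using (-‿distribʳ-*; [y-z]x≈yx-zx; -‿involutive)
  open import Algebra.Properties.CommutativeSemigroup +-commutativeSemigroup using (interchange)

  private
    Σ : ℕ → (ℕ → Carrier) → Carrier
    Σ = Σ≤ R

  Σ≤-cong : ∀ n {f g : ℕ → Carrier} → (∀ i → i ≤ n → f i ≈ g i) → Σ n f ≈ Σ n g
  Σ≤-cong zero    f≈g = f≈g 0 z≤n
  Σ≤-cong (suc n) f≈g =
    +-cong (Σ≤-cong n (λ i i≤n → f≈g i (ℕ.m≤n⇒m≤1+n i≤n))) (f≈g (suc n) ℕ.≤-refl)

  Σ≤-extend : ∀ {n N} (f : ℕ → Carrier) → n ≤ N →
              (∀ i → n < i → i ≤ N → f i ≈ 0#) → Σ N f ≈ Σ n f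
  Σ≤-extend f n≤N = go (ℕ.≤⇒≤′ n≤N)
    where
    go : ∀ {n N} → n ≤′ N → (∀ i → n < i → i ≤ N → f i ≈ 0#) → Σ N f ≈ Σ n f
    go ≤′-refl             _      = refl
    go {n} {suc N} (≤′-step n≤′N) vanish = begin
      Σ N f ⊕ f (suc N) ≈⟨ +-cong (go n≤′N (λ i n<i i≤N → vanish i n<i (ℕ.m≤n⇒m≤1+n i≤N)))
                                  (vanish (suc N) (s≤s (ℕ.≤′⇒≤ n≤′N)) ℕ.≤-refl) ⟩
      Σ n f ⊕ 0#        ≈⟨ +-identityʳ _ ⟩
      Σ n f             ∎

  Σ≤-head : ∀ n (f : ℕ → Carrier) → Σ (suc n) f ≈ f 0 ⊕ Σ n (λ i → f (suc i))
  Σ≤-head zero    f = refl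
  Σ≤-head (suc n) f = begin
    Σ (suc n) f ⊕ f (suc (suc n))                   ≈⟨ +-congʳ (Σ≤-head n f) ⟩
    (f 0 ⊕ Σ n (λ i → f (suc i))) ⊕ f (suc (suc n)) ≈⟨ +-assoc _ _ _ ⟩
    f 0 ⊕ Σ (suc n) (λ i → f (suc i))               ∎

  Σ≤-reverse : ∀ n (f : ℕ → Carrier) → Σ n f ≈ Σ n (λ i → f (n ∸ i))
  Σ≤-reverse zero    f = refl
  Σ≤-reverse (suc n) f = begin
    Σ n f ⊕ f (suc n)                 ≈⟨ +-congʳ (Σ≤-reverse n f) ⟩
    Σ n (λ i → f (n ∸ i)) ⊕ f (suc n) ≈⟨ +-comm _ _ ⟩
    f (suc n) ⊕ Σ n (λ i → f (n ∸ i)) ≈⟨ Σ≤-head n (λ i → f (suc n ∸ i)) ⟨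
    Σ (suc n) (λ i → f (suc n ∸ i))   ∎

  Σ≤-split : ∀ a b (f : ℕ → Carrier) → Σ (suc (a + b)) f ≈ Σ a f ⊕ Σ b (λ i → f (suc (a + i)))
  Σ≤-split a zero    f rewrite ℕ.+-identityʳ a = refl
  Σ≤-split a (suc b) f = begin
    Σ (suc (a + suc b)) f                                           ≡⟨ P.cong (λ x → Σ (suc x) f) (ℕ.+-suc a b) ⟩
    Σ (suc (a + b)) f ⊕ f (suc (suc (a + b)))                       ≈⟨ +-congʳ (Σ≤-split a b f) ⟩
    (Σ a f ⊕ Σ b (λ i → f (suc (a + i)))) ⊕ f (suc (suc (a + b)))   ≈⟨ +-assoc _ _ _ ⟩
    Σ a f ⊕ (Σ b (λ i → f (suc (a + i))) ⊕ f (suc (suc (a + b))))   ≈⟨ +-congˡ (+-congˡ (reflexive (P.cong (λ x → f (suc x)) (ℕ.+-suc a b)))) ⟨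
    Σ a f ⊕ Σ (suc b) (λ i → f (suc (a + i)))                       ∎

  Σ≤-distrib-+ : ∀ n (f g : ℕ → Carrier) → Σ n (λ i → f i ⊕ g i) ≈ Σ n f ⊕ Σ n g
  Σ≤-distrib-+ zero    f g = refl
  Σ≤-distrib-+ (suc n) f g = begin
    Σ n (λ i → f i ⊕ g i) ⊕ (f (suc n) ⊕ g (suc n)) ≈⟨ +-congʳ (Σ≤-distrib-+ n f g) ⟩
    (Σ n f ⊕ Σ n g) ⊕ (f (suc n) ⊕ g (suc n))       ≈⟨ interchange _ _ _ _ ⟩
    Σ (suc n) f ⊕ Σ (suc n) g                       ∎

  Σ≤-fold-odd : ∀ n (f : ℕ → Carrier) →
                Σ (suc (n + n)) f ≈ Σ n (λ i → f i ⊕ f (suc (n + n) ∸ i))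
  Σ≤-fold-odd n f = begin
    Σ (suc (n + n)) f                               ≈⟨ Σ≤-split n n f ⟩
    Σ n f ⊕ Σ n (λ i → f (suc (n + i)))             ≈⟨ +-congˡ (Σ≤-reverse n _) ⟩
    Σ n f ⊕ Σ n (λ i → f (suc (n + (n ∸ i))))       ≈⟨ +-congˡ (Σ≤-cong n mirror) ⟩
    Σ n f ⊕ Σ n (λ i → f (suc (n + n) ∸ i))         ≈⟨ Σ≤-distrib-+ n _ _ ⟨
    Σ n (λ i → f i ⊕ f (suc (n + n) ∸ i))           ∎
    where
    mirror : ∀ i → i ≤ n → f (suc (n + (n ∸ i))) ≈ f (suc (n + n) ∸ i)
    mirror i i≤n = reflexive (P.cong f (P.sym (ℕ.+-∸-assoc (suc n) i≤n)))

  -- The coefficient of x^k in x^i (1+x)^n; unlike ⟦ n C (k ∸ i) ⟧ it is 0 when i > k.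
  shiftedBinomial : ℕ → ℕ → ℕ → Carrier
  shiftedBinomial n i k with i ≤? k
  ... | yes _ = ⟦ R ⟧ (n C (k ∸ i))
  ... | no  _ = 0#

  shiftedBinomial-≤ : ∀ n {i k} → i ≤ k → shiftedBinomial n i k ≡ ⟦ R ⟧ (n C (k ∸ i))
  shiftedBinomial-≤ n {i} {k} i≤k with i ≤? k
  ... | yes _   = P.refl
  ... | no  i≰k = ⊥-elim (i≰k i≤k)

  shiftedBinomial-> : ∀ n {i k} → k < i → shiftedBinomial n i k ≡ 0#
  shiftedBinomial-> n {i} {k} k<i with i ≤? k
  ... | yes i≤k = ⊥-elim (ℕ.<⇒≱ k<i i≤k)
  ... | no  _   = P.refl

  shiftedBinomial-shift : ∀ n a i k → shiftedBinomial n (a + i) (a + k) ≡ shiftedBinomial n i k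
  shiftedBinomial-shift n a i k with i ≤? k
  ... | yes i≤k = P.trans (shiftedBinomial-≤ n (ℕ.+-monoʳ-≤ a i≤k))
                          (P.cong (λ x → ⟦ R ⟧ (n C x)) (ℕ.[m+n]∸[m+o]≡n∸o a k i))
  ... | no  i≰k = shiftedBinomial-> n (ℕ.+-monoʳ-< a (ℕ.≰⇒> i≰k))

  binArr-≈-Σ≤-shiftedBinomial : ∀ {q : ℕ → Carrier} M → (∀ i → M < i → q i ≈ 0#) → ∀ k n →
                                binArr R q k n ≈ Σ M (λ i → shiftedBinomial n i k ⊛ q i)
  binArr-≈-Σ≤-shiftedBinomial {q} M q-vanishes k n = begin
    binArr R q k n ≈⟨ Σ≤-cong k (λ i i≤k → *-congʳ (reflexive (P.sym (shiftedBinomial-≤ n i≤k)))) ⟩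
    Σ k f          ≈⟨ Σ≤-extend f (ℕ.m≤n+m k M) (λ i k<i _ → beyond-k i k<i) ⟨
    Σ (M + k) f    ≈⟨ Σ≤-extend f (ℕ.m≤m+n M k) (λ i M<i _ → beyond-M i M<i) ⟩
    Σ M f          ∎
    where
    f : ℕ → Carrier
    f i = shiftedBinomial n i k ⊛ q i
    beyond-k : ∀ i → k < i → f i ≈ 0#
    beyond-k i k<i = trans (*-congʳ (reflexive (shiftedBinomial-> n k<i))) (zeroˡ _)
    beyond-M : ∀ i → M < i → f i ≈ 0#
    beyond-M i M<i = trans (*-congˡ (q-vanishes i M<i)) (zeroʳ _)

  oneMinusX^-top : ∀ j → oneMinusX^ R j (suc (j + j)) ≡ - 1#
  oneMinusX^-top j with (j + j) ≡ᵇ (j + j) | ℕ.≡⇒≡ᵇ (j + j) (j + j) P.refl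
  ... | true | _ = P.refl

  oneMinusX^-off : ∀ j i → i ≢ j + j → oneMinusX^ R j (suc i) ≡ 0#
  oneMinusX^-off j i i≢2j with i ≡ᵇ (j + j) | ℕ.≡ᵇ⇒≡ i (j + j)
  ... | false | _    = P.refl
  ... | true  | i≡2j = ⊥-elim (i≢2j (i≡2j _))

  binArr-oneMinusX^ : ∀ j k n →
    binArr R (oneMinusX^ R j) k n ≈ shiftedBinomial n 0 k ⊕ - shiftedBinomial n (suc (j + j)) k
  binArr-oneMinusX^ j k n = begin
    binArr R e k n                   ≈⟨ binArr-≈-Σ≤-shiftedBinomial (suc (j + j)) tail k n ⟩
    Σ (j + j) f ⊕ w (suc (j + j)) ⊛ e (suc (j + j))
      ≈⟨ +-cong (Σ≤-extend f z≤n middle) (*-congˡ (reflexive (oneMinusX^-top j))) ⟩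
    w 0 ⊛ 1# ⊕ w (suc (j + j)) ⊛ - 1#
      ≈⟨ +-cong (*-identityʳ _) (trans (sym (-‿distribʳ-* _ _)) (-‿cong (*-identityʳ _))) ⟩
    w 0 ⊕ - w (suc (j + j))          ∎
    where
    e : ℕ → Carrier
    e = oneMinusX^ R j
    w : ℕ → Carrier
    w i = shiftedBinomial n i k
    f : ℕ → Carrier
    f i = w i ⊛ e i
    tail : ∀ i → suc (j + j) < i → e i ≈ 0#
    tail (suc i) (s≤s 2j<i) = reflexive (oneMinusX^-off j i (ℕ.>⇒≢ 2j<i))
    middle : ∀ i → 0 < i → i ≤ j + j → f i ≈ 0#
    middle (suc i) _ i<2j =
      trans (*-congˡ (reflexive (oneMinusX^-off j i (ℕ.<⇒≢ i<2j)))) (zeroʳ _)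

  binArr-skewPalindromic : ∀ m′ (d : ℕ → Carrier) →
    (∀ i → suc (m′ + m′) < i → d i ≈ 0#) → SkewPalindromic R d (suc (m′ + m′)) →
    ∀ t n → binArr R d (m′ + t) n
          ≈ Σ m′ (λ i → d i ⊛ binArr R (oneMinusX^ R (m′ ∸ i)) ((m′ ∸ i) + t) n)
  binArr-skewPalindromic m′ d d-vanishes skew t n = begin
    binArr R d k n                             ≈⟨ binArr-≈-Σ≤-shiftedBinomial m d-vanishes k n ⟩
    Σ m (λ i → w i ⊛ d i)                      ≈⟨ Σ≤-fold-odd m′ _ ⟩
    Σ m′ (λ i → w i ⊛ d i ⊕ w (m ∸ i) ⊛ d (m ∸ i)) ≈⟨ Σ≤-cong m′ pair ⟩
    Σ m′ (λ i → d i ⊛ binArr R (oneMinusX^ R (m′ ∸ i)) ((m′ ∸ i) + t) n) ∎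
    where
    m = suc (m′ + m′)
    k = m′ + t
    w : ℕ → Carrier
    w i = shiftedBinomial n i k
    pair : ∀ i → i ≤ m′ → w i ⊛ d i ⊕ w (m ∸ i) ⊛ d (m ∸ i)
                       ≈ d i ⊛ binArr R (oneMinusX^ R (m′ ∸ i)) ((m′ ∸ i) + t) n
    pair i i≤m′ with m′ ∸ i | ℕ.m+[n∸m]≡n i≤m′
    ... | j | P.refl = begin
      w i ⊛ d i ⊕ w (m ∸ i) ⊛ d (m ∸ i)           ≈⟨ +-congˡ (*-congˡ mirror) ⟩
      w i ⊛ d i ⊕ w (m ∸ i) ⊛ - d i               ≈⟨ +-congˡ (-‿distribʳ-* _ _) ⟨
      w i ⊛ d i ⊕ - (w (m ∸ i) ⊛ d i)             ≈⟨ [y-z]x≈yx-zx _ _ _ ⟨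
      (w i ⊕ - w (m ∸ i)) ⊛ d i                   ≈⟨ *-comm _ _ ⟩
      d i ⊛ (w i ⊕ - w (m ∸ i))                   ≡⟨ P.cong₂ (λ x y → d i ⊛ (x ⊕ - y)) shift-i shift-m∸i ⟩
      d i ⊛ (w′ 0 ⊕ - w′ (suc (j + j)))           ≈⟨ *-congˡ (binArr-oneMinusX^ j (j + t) n) ⟨
      d i ⊛ binArr R (oneMinusX^ R j) (j + t) n   ∎
      where
      w′ : ℕ → Carrier
      w′ l = shiftedBinomial n l (j + t)
      mirror : d (m ∸ i) ≈ - d i
      mirror = trans (sym (-‿involutive _))
                     (-‿cong (sym (skew i (ℕ.≤-trans (ℕ.m≤m+n i j) (ℕ.m≤n⇒m≤1+n (ℕ.m≤m+n (i + j) (i + j)))))))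
      reassoc : ∀ i j → suc ((i + j) + (i + j)) ≡ i + (i + suc (j + j))
      reassoc = solve-∀
      shift-i : w i ≡ w′ 0
      shift-i = P.trans (P.cong₂ (shiftedBinomial n) (P.sym (ℕ.+-identityʳ i)) (ℕ.+-assoc i j t))
                        (shiftedBinomial-shift n i 0 (j + t))
      shift-m∸i : w (m ∸ i) ≡ w′ (suc (j + j))
      shift-m∸i = P.trans (P.cong₂ (shiftedBinomial n)
                                   (P.trans (P.cong (_∸ i) (reassoc i j)) (ℕ.m+n∸m≡n i _))
                                   (ℕ.+-assoc i j t))
                          (shiftedBinomial-shift n i (suc (j + j)) (j + t))

theorem8p11 : {c ℓ : Level} (F : CommutativeRing c ℓ) → IsCharZeroField F →
    (m′ : ℕ) (d : ℕ → CommutativeRing.Carrier F) →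
    HasDegree F d (2 * m′ + 1) → SkewPalindromic F d (2 * m′ + 1) →
    (t : ℕ) → t ≥ 1 →
    CommutativeRing._≈_ F (binArr F d (m′ + t) (2 * t))
    (Σ≤ F m′ (λ i → CommutativeRing._*_ F (d i) (c[2_+1] F (m′ ∸ i) t)))
theorem8p11 F _ m′ d (_ , d-vanishes) skew t _ =
  CommutativeRing.trans F
    (CommutativeRing.reflexive F (P.cong (binArr F d (m′ + t)) (2m≡m+m t)))
    (binArr-skewPalindromic F m′ d
      (P.subst (λ m → ∀ i → m < i → CommutativeRing._≈_ F (d i) (CommutativeRing.0# F)) (2m+1≡1+m+m m′) d-vanishes)
      (P.subst (SkewPalindromic F d) (2m+1≡1+m+m m′) skew)
      t (t + t))
  where
  2m≡m+m : ∀ m → 2 * m ≡ m + m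
  2m≡m+m = solve-∀
  2m+1≡1+m+m : ∀ m → 2 * m + 1 ≡ suc (m + m)
  2m+1≡1+m+m = solve-∀
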